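{- Let $G=(V,E)$ be a finite connected undirected simple graph and let $n(G)=|E|-|V|+1$. Then, as an identity of Laurent polynomials in $\xi$, \[ \theta_G(1,\xi)=\sum_{k=0}^{n(G)}\binom{n(G)}{k} f_{2k}(\xi-\xi^{ -1}). \]
   Context: The polynomials $f_n$ are defined by $f_0(x)=1$, $f_1(x)=0$, $f_{n+1}(x)=xf_n(x)+f_{n-1}(x)$. For a graph $G=(V,E)$, $\theta_G(\beta,\xi)=\sum_{s\subset E}\beta^{|s|}\prod_{i\in V}f_{d_i(s)}(\xi-\xi^{ -1})$, a Laurent polynomial in $\beta,\xi$, where the sum runs over all subsets $s$ of $E$ and $d_i(s)$ is the number of edges of $s$ incident to node $i$. -}

module Defs where

open import Level using (Level)
open import Data.Nat using (ℕ; zero; suc; _<_)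
import Data.Nat as ℕ
open import Data.Nat.Combinatorics using (_C_)
open import Data.Bool using (Bool; true; false; if_then_else_)
open import Data.Fin using (Fin; toℕ; _≟_)
import Data.Fin
open import Data.Product using (_×_; _,_; ∃; proj₁; proj₂)
open import Data.Sum using (_⊎_)
open import Data.Vec using (Vec; []; _∷_; lookup)
open import Data.List using (List; []; _∷_; map; _++_; upTo)
open import Relation.Nullary using (yes; no)
open import Relation.Binary.PropositionalEquality using (_≡_)
open import Relation.Binary.Construct.Closure.ReflexiveTransitive using (Star)
open import Algebra.Bundles using (CommutativeRing)

-- Simple: every edge (i , j) satisfies toℕ i < toℕ j (no loops, each
-- unordered pair written in a normal orientation) and distinct
-- positions carry distinct edges (no multiple edges).
SimpleEdges : ∀ {n m} → Vec (Fin n × Fin n) m → Set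
SimpleEdges {n} {m} E =
  (∀ (e : Fin m) → toℕ (proj₁ (lookup E e)) < toℕ (proj₂ (lookup E e)))
  × (∀ (e e′ : Fin m) → lookup E e ≡ lookup E e′ → e ≡ e′)

Adjacent : ∀ {n m} → Vec (Fin n × Fin n) m → Fin n → Fin n → Set
Adjacent {n} {m} E i j =
  ∃ λ (e : Fin m) → (lookup E e ≡ (i , j)) ⊎ (lookup E e ≡ (j , i))

Connected : ∀ {n m} → Vec (Fin n × Fin n) m → Set
Connected {n} E = ∀ (i j : Fin n) → Star (Adjacent E) i j

allSubsets : (m : ℕ) → List (Vec Bool m)
allSubsets zero = [] ∷ []
allSubsets (suc m) = map (true ∷_) (allSubsets m) ++ map (false ∷_) (allSubsets m)

size : ∀ {m} → Vec Bool m → ℕ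
size [] = 0
size (true ∷ s) = suc (size s)
size (false ∷ s) = size s

incident : ∀ {n} → Fin n → Fin n × Fin n → Bool
incident i (a , b) with i ≟ a | i ≟ b
... | yes _ | _ = true
... | no _ | yes _ = true
... | no _ | no _ = false

degree : ∀ {n m} → Vec (Fin n × Fin n) m → Vec Bool m → Fin n → ℕ
degree [] [] i = 0
degree (e ∷ E) (true ∷ s) i = (if incident i e then 1 else 0) ℕ.+ degree E s i
degree (e ∷ E) (false ∷ s) i = degree E s i

-- An identity of Laurent polynomials in ξ (with
-- integer coefficients) is expressed via the universal property of
-- ℤ[ξ, ξ⁻¹]: it holds in every commutative ring for every unit ξ.

module RingDefs {c ℓ : Level} (R : CommutativeRing c ℓ) where
  open CommutativeRing R

  _·_ : ℕ → Carrier → Carrier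
  zero · x = 0#
  suc k · x = x + (k · x)

  _^_ : Carrier → ℕ → Carrier
  x ^ zero = 1#
  x ^ suc k = x * (x ^ k)

  f : ℕ → Carrier → Carrier
  f zero x = 1#
  f (suc zero) x = 0#
  f (suc (suc k)) x = x * f (suc k) x + f k x

  sumL : List Carrier → Carrier
  sumL [] = 0#
  sumL (a ∷ as) = a + sumL as

  prodFin : (n : ℕ) → (Fin n → Carrier) → Carrier
  prodFin zero g = 1#
  prodFin (suc n) g = g Data.Fin.zero * prodFin n (λ i → g (Data.Fin.suc i))

  θ : ∀ {n m} → Vec (Fin n × Fin n) m → Carrier → Carrier → Carrier → Carrier
  θ {n} {m} E β ξ ξinv =
    sumL (map (λ s → (β ^ size s) * prodFin n (λ i → f (degree E s i) (ξ - ξinv)))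
              (allSubsets m))

  rhs : ℕ → Carrier → Carrier
  rhs N x = sumL (map (λ k → (N C k) · f (2 ℕ.* k) x) (upTo (suc N)))

-- Put x = ξ - ξ⁻¹ and generalise θ_G(1, ξ) to Θ_D(E) = Σ_{s ⊆ E} Π_i f_{D i + d_i(s)}(x) for
-- multigraphs with loops (a loop adds 2 to the degree of its vertex) and arbitrary initial
-- degrees D. Summing over whether a non-loop edge uv lies in s, the addition law
-- f_{a+b} = f_a f_b + f_{a+1} f_{b+1} shows that Θ is unchanged when uv is contracted and the
-- merged vertex gets initial degree D u + D v. Contracting |V| - 1 edges of a connected graph
-- leaves a single vertex carrying n(G) loops, each raising its degree by 0 or 2, so Pascal's
-- rule gives Σ_k C(n(G), k) f_{2k}(x).

module Submission where

open import Defs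
open import Data.Nat using (ℕ; zero; suc; _+_; _*_; _∸_; _<_)
import Data.Nat.Properties as ℕ
open import Data.Nat.Combinatorics using (_C_; nCk+nC[k+1]≡[n+1]C[k+1]; k>n⇒nCk≡0)
open import Data.Nat.Solver using (module +-*-Solver)
open import Data.Fin using (Fin; toℕ; punchIn; punchOut; _≟_) renaming (zero to fzero; suc to fsuc)
import Data.Fin.Properties as Fin
open import Data.Product using (_×_; _,_; ∃; ∃₂; proj₁; proj₂)
open import Data.Sum using (_⊎_; inj₁; inj₂)
import Data.Sum as ⊎
open import Data.Bool using (Bool; true; false; if_then_else_)
open import Data.Vec using (Vec; []; _∷_; lookup; toList)
import Data.Vec.Properties as Vec
open import Data.Vec.Membership.Propositional.Properties using (∈-lookup; ∈-toList⁺)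
open import Data.List using (List; []; _∷_; map; _++_; length; applyUpTo)
import Data.List.Properties as List
open import Data.List.Membership.Propositional using (_∈_)
open import Data.List.Membership.Propositional.Properties using (∈-map⁺; ∈-∃++)
open import Data.List.Relation.Unary.Any using (here; there)
open import Data.List.Relation.Binary.Permutation.Propositional as ↭ using (_↭_; prep; swap)
open import Data.List.Relation.Binary.Permutation.Propositional.Properties using (shift; ∈-resp-↭; ↭-length)
open import Relation.Binary.Construct.Closure.ReflexiveTransitive as Star using (Star; ε; _◅_; kleisliStar)
open import Relation.Nullary using (yes; no)
open import Relation.Nullary.Negation using (contradiction)
open import Relation.Binary.PropositionalEquality
  using (_≡_; _≢_; refl; sym; trans; cong; cong₂; subst; subst₂; ≢-sym; module ≡-Reasoning)
open import Algebra.Bundles using (CommutativeRing)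
open import Algebra.Properties.CommutativeSemigroup ℕ.+-commutativeSemigroup using (xy∙z≈xz∙y)

δ : ∀ {n} → Fin n → Fin n → ℕ
δ i a with i ≟ a
... | yes _ = 1
... | no _ = 0

δ-≡ : ∀ {n} {i a : Fin n} → i ≡ a → δ i a ≡ 1
δ-≡ {i = i} {a} i≡a with i ≟ a
... | yes _ = refl
... | no i≢a = contradiction i≡a i≢a

δ-≢ : ∀ {n} {i a : Fin n} → i ≢ a → δ i a ≡ 0
δ-≢ {i = i} {a} i≢a with i ≟ a
... | yes i≡a = contradiction i≡a i≢a
... | no _ = refl

δ-resp-⇔ : ∀ {m n} {i a : Fin m} {j b : Fin n} → (i ≡ a → j ≡ b) → (j ≡ b → i ≡ a) → δ i a ≡ δ j b
δ-resp-⇔ {i = i} {a} to from with i ≟ a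
... | yes i≡a = sym (δ-≡ (to i≡a))
... | no i≢a = sym (δ-≢ (λ j≡b → i≢a (from j≡b)))

-- Unlike Defs.incident, this counts a loop (a , a) twice at a.
inc : ∀ {n} → Fin n → Fin n × Fin n → ℕ
inc i (a , b) = δ i a + δ i b

addEdge : ∀ {n} → (Fin n → ℕ) → Fin n × Fin n → Fin n → ℕ
addEdge D e i = D i + inc i e

addEdge-comm : ∀ {n} (D : Fin n → ℕ) a b i → addEdge (addEdge D a) b i ≡ addEdge (addEdge D b) a i
addEdge-comm D a b i = xy∙z≈xz∙y (D i) (inc i a) (inc i b)

incident≡inc : ∀ {n} (i a b : Fin n) → a ≢ b → (if incident i (a , b) then 1 else 0) ≡ inc i (a , b)
incident≡inc i a b a≢b with i ≟ a | i ≟ b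
... | yes i≡a | yes i≡b = contradiction (trans (sym i≡a) i≡b) a≢b
... | yes _ | no _ = refl
... | no _ | yes _ = refl
... | no _ | no _ = refl

Adjacentˡ : ∀ {n} → List (Fin n × Fin n) → Fin n → Fin n → Set
Adjacentˡ E i j = (i , j) ∈ E ⊎ (j , i) ∈ E

Connectedˡ : ∀ {n} → List (Fin n × Fin n) → Set
Connectedˡ E = ∀ i j → Star (Adjacentˡ E) i j

Connected⇒Connectedˡ : ∀ {n m} {E : Vec (Fin n × Fin n) m} → Connected E → Connectedˡ (toList E)
Connected⇒Connectedˡ {E = E} connected i j = Star.map adjacent (connected i j)
  where
  adjacent : ∀ {i j} → Adjacent E i j → Adjacentˡ (toList E) i j
  adjacent (e , inj₁ eq) = inj₁ (subst (_∈ toList E) eq (∈-toList⁺ (∈-lookup e E)))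
  adjacent (e , inj₂ eq) = inj₂ (subst (_∈ toList E) eq (∈-toList⁺ (∈-lookup e E)))

Connectedˡ-resp-↭ : ∀ {n} {E E′ : List (Fin n × Fin n)} → E ↭ E′ → Connectedˡ E → Connectedˡ E′
Connectedˡ-resp-↭ E↭E′ connected i j = Star.map (⊎.map (∈-resp-↭ E↭E′) (∈-resp-↭ E↭E′)) (connected i j)

nonLoopEdge : ∀ {n} {E : List (Fin n × Fin n)} {i j} → Star (Adjacentˡ E) i j → i ≢ j →
              ∃₂ λ a b → a ≢ b × (a , b) ∈ E
nonLoopEdge ε i≢i = contradiction refl i≢i
nonLoopEdge {i = i} (_◅_ {j = k} i~k k~j) i≢j with i ≟ k
... | yes refl = nonLoopEdge k~j i≢j
... | no i≢k with i~k
...   | inj₁ ik∈E = i , k , i≢k , ik∈E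
...   | inj₂ ki∈E = k , i , ≢-sym i≢k , ki∈E

∈⇒↭∷ : ∀ {A : Set} {x : A} {xs} → x ∈ xs → ∃ λ ys → xs ↭ x ∷ ys
∈⇒↭∷ x∈xs with ys , zs , refl ← ∈-∃++ x∈xs = ys ++ zs , shift _ ys zs

-- Contracting the edge (u , v): v is merged into u and the other vertices are renumbered by punchOut v.
module Contraction {n} (u v : Fin (suc (suc n))) (u≢v : u ≢ v) where

  ū : Fin (suc n)
  ū = punchOut (≢-sym u≢v)

  merge : Fin (suc (suc n)) → Fin (suc n)
  merge y with y ≟ v
  ... | yes _ = ū
  ... | no y≢v = punchOut (≢-sym y≢v)

  mergeEdge : Fin (suc (suc n)) × Fin (suc (suc n)) → Fin (suc n) × Fin (suc n)
  mergeEdge (a , b) = merge a , merge b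

  -- push D k is the sum of D over the fibre of merge above k.
  push : (Fin (suc (suc n)) → ℕ) → Fin (suc n) → ℕ
  push D k = D (punchIn v k) + δ k ū * D v

  merge-v : merge v ≡ ū
  merge-v with v ≟ v
  ... | yes _ = refl
  ... | no v≢v = contradiction refl v≢v

  merge-u : merge u ≡ ū
  merge-u with u ≟ v
  ... | yes u≡v = contradiction u≡v u≢v
  ... | no _ = Fin.punchOut-cong v refl

  merge-punchIn : ∀ k → merge (punchIn v k) ≡ k
  merge-punchIn k with punchIn v k ≟ v
  ... | yes eq = contradiction eq (Fin.punchInᵢ≢i v k)
  ... | no _ = trans (Fin.punchOut-cong v refl) (Fin.punchOut-punchIn v)

  δ-merge : ∀ k y → δ (punchIn v k) y + δ k ū * δ v y ≡ δ k (merge y)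
  δ-merge k y with y ≟ v
  ... | yes refl rewrite δ-≢ (Fin.punchInᵢ≢i v k) | δ-≡ {i = v} refl = ℕ.*-identityʳ (δ k ū)
  ... | no y≢v rewrite δ-≢ (≢-sym y≢v) | ℕ.*-zeroʳ (δ k ū) | ℕ.+-identityʳ (δ (punchIn v k) y) =
    δ-resp-⇔ (λ eq → Fin.punchIn-injective v k _ (trans eq (sym (Fin.punchIn-punchOut _))))
             (λ eq → trans (cong (punchIn v) eq) (Fin.punchIn-punchOut _))

  push-addEdge : ∀ D e k → push (addEdge D e) k ≡ addEdge (push D) (mergeEdge e) k
  push-addEdge D (a , b) k = begin
    D (punchIn v k) + (δ (punchIn v k) a + δ (punchIn v k) b) + δ k ū * (D v + (δ v a + δ v b))
      ≡⟨ solve 7 (λ Dk Dv d p q r s → Dk :+ (p :+ q) :+ d :* (Dv :+ (r :+ s))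
                                   := Dk :+ d :* Dv :+ ((p :+ d :* r) :+ (q :+ d :* s)))
                 refl (D (punchIn v k)) (D v) (δ k ū) (δ (punchIn v k) a) (δ (punchIn v k) b) (δ v a) (δ v b) ⟩
    push D k + ((δ (punchIn v k) a + δ k ū * δ v a) + (δ (punchIn v k) b + δ k ū * δ v b))
      ≡⟨ cong (push D k +_) (cong₂ _+_ (δ-merge k a) (δ-merge k b)) ⟩
    push D k + (δ k (merge a) + δ k (merge b)) ∎
    where
    open +-*-Solver
    open ≡-Reasoning

  push-zero : ∀ k → push (λ _ → 0) k ≡ 0
  push-zero k = ℕ.*-zeroʳ (δ k ū)

  others : Fin n → Fin (suc (suc n))
  others j = punchIn v (punchIn ū j)

  punchIn-ū : punchIn v ū ≡ u
  punchIn-ū = Fin.punchIn-punchOut (≢-sym u≢v)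

  addEdge-v : ∀ D → addEdge D (u , v) v ≡ suc (D v)
  addEdge-v D rewrite δ-≢ (≢-sym u≢v) | δ-≡ {i = v} refl = ℕ.+-comm (D v) 1

  addEdge-u : ∀ D → addEdge D (u , v) (punchIn v ū) ≡ suc (D (punchIn v ū))
  addEdge-u D rewrite δ-≡ punchIn-ū | δ-≢ (Fin.punchInᵢ≢i v ū) = ℕ.+-comm (D (punchIn v ū)) 1

  addEdge-others : ∀ D j → addEdge D (u , v) (others j) ≡ D (others j)
  addEdge-others D j
    rewrite δ-≢ {i = others j} {a = u}
              (λ eq → Fin.punchInᵢ≢i ū j (Fin.punchIn-injective v _ _ (trans eq (sym punchIn-ū))))
          | δ-≢ (Fin.punchInᵢ≢i v (punchIn ū j)) = ℕ.+-identityʳ (D (others j))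

  push-ū : ∀ D → push D ū ≡ D (punchIn v ū) + D v
  push-ū D rewrite δ-≡ {i = ū} refl = cong (D (punchIn v ū) +_) (ℕ.*-identityˡ (D v))

  push-others : ∀ D j → push D (punchIn ū j) ≡ D (others j)
  push-others D j rewrite δ-≢ (Fin.punchInᵢ≢i ū j) = ℕ.+-identityʳ (D (others j))

  merge-Adjacentˡ : ∀ {E i j} → Adjacentˡ ((u , v) ∷ E) i j → Star (Adjacentˡ (map mergeEdge E)) (merge i) (merge j)
  merge-Adjacentˡ (inj₁ (here refl)) = subst (Star _ (merge u)) (trans merge-u (sym merge-v)) ε
  merge-Adjacentˡ (inj₂ (here refl)) = subst (Star _ (merge v)) (trans merge-v (sym merge-u)) ε
  merge-Adjacentˡ (inj₁ (there ij∈E)) = inj₁ (∈-map⁺ mergeEdge ij∈E) ◅ ε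
  merge-Adjacentˡ (inj₂ (there ji∈E)) = inj₂ (∈-map⁺ mergeEdge ji∈E) ◅ ε

  Connectedˡ-merge : ∀ {E} → Connectedˡ ((u , v) ∷ E) → Connectedˡ (map mergeEdge E)
  Connectedˡ-merge connected k l =
    subst₂ (Star _) (merge-punchIn k) (merge-punchIn l)
      (kleisliStar merge merge-Adjacentˡ (connected (punchIn v k) (punchIn v l)))

module Expansion {c ℓ} (R : CommutativeRing c ℓ) (x : CommutativeRing.Carrier R) where
  open CommutativeRing R
    renaming (_+_ to _⊕_; _*_ to _⊗_; refl to ≈-refl; sym to ≈-sym; trans to ≈-trans; reflexive to ≈-reflexive)
  open RingDefs R
  open import Relation.Binary.Reasoning.Setoid setoid
  open import Algebra.Solver.Ring.NaturalCoefficients.Default commutativeSemiring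

  F : ℕ → Carrier
  F k = f k x

  F-cong : ∀ {k l} → k ≡ l → F k ≈ F l
  F-cong k≡l = ≈-reflexive (cong F k≡l)

  f-+ : ∀ a b → F (a + b) ≈ F a ⊗ F b ⊕ F (suc a) ⊗ F (suc b)
  f-+ zero b = solve 2 (λ Fb Fb′ → Fb := con 1 :* Fb :+ con 0 :* Fb′) ≈-refl (F b) (F (suc b))
  f-+ (suc zero) b = solve 3 (λ y Fb Fb′ → Fb′ := con 0 :* Fb :+ (y :* con 0 :+ con 1) :* Fb′) ≈-refl x (F b) (F (suc b))
  f-+ (suc (suc a)) b = begin
    x ⊗ F (suc a + b) ⊕ F (a + b) ≈⟨ +-cong (*-congˡ (f-+ (suc a) b)) (f-+ a b) ⟩
    x ⊗ (F (suc a) ⊗ F b ⊕ F (suc (suc a)) ⊗ F (suc b)) ⊕ (F a ⊗ F b ⊕ F (suc a) ⊗ F (suc b))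
      ≈⟨ solve 5 (λ y A0 A1 B0 B1 → y :* (A1 :* B0 :+ (y :* A1 :+ A0) :* B1) :+ (A0 :* B0 :+ A1 :* B1)
                  := (y :* A1 :+ A0) :* B0 :+ (y :* (y :* A1 :+ A0) :+ A1) :* B1)
               ≈-refl x (F a) (F (suc a)) (F b) (F (suc b)) ⟩
    F (suc (suc a)) ⊗ F b ⊕ F (suc (suc (suc a))) ⊗ F (suc b) ∎

  prodFin-cong : ∀ n {g h : Fin n → Carrier} → (∀ i → g i ≈ h i) → prodFin n g ≈ prodFin n h
  prodFin-cong zero g≈h = ≈-refl
  prodFin-cong (suc n) g≈h = *-cong (g≈h fzero) (prodFin-cong n (λ i → g≈h (fsuc i)))

  prodFin-punchIn : ∀ n (v : Fin (suc n)) g → prodFin (suc n) g ≈ g v ⊗ prodFin n (λ k → g (punchIn v k))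
  prodFin-punchIn n fzero g = ≈-refl
  prodFin-punchIn (suc n) (fsuc v) g = begin
    g fzero ⊗ prodFin (suc n) (λ i → g (fsuc i))
      ≈⟨ *-congˡ (prodFin-punchIn n v (λ i → g (fsuc i))) ⟩
    g fzero ⊗ (g (fsuc v) ⊗ prodFin n (λ k → g (fsuc (punchIn v k))))
      ≈⟨ solve 3 (λ p q r → p :* (q :* r) := q :* (p :* r)) ≈-refl _ _ _ ⟩
    g (fsuc v) ⊗ (g fzero ⊗ prodFin n (λ k → g (fsuc (punchIn v k)))) ∎

  weight : ∀ {n} → (Fin n → ℕ) → Carrier
  weight {n} D = prodFin n (λ i → F (D i))

  weight-cong : ∀ {n} {D D′ : Fin n → ℕ} → (∀ i → D i ≡ D′ i) → weight D ≈ weight D′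
  weight-cong {n} D≗D′ = prodFin-cong n (λ i → F-cong (D≗D′ i))

  -- Θ D E = Σ_{s ⊆ E} Π_i f_{D i + d_i(s)}(x), splitting on whether the first edge lies in s.
  Θ : ∀ {n} → (Fin n → ℕ) → List (Fin n × Fin n) → Carrier
  Θ D [] = weight D
  Θ D (e ∷ E) = Θ D E ⊕ Θ (addEdge D e) E

  Θ-cong : ∀ {n} (E : List (Fin n × Fin n)) {D D′ : Fin n → ℕ} → (∀ i → D i ≡ D′ i) → Θ D E ≈ Θ D′ E
  Θ-cong [] D≗D′ = weight-cong D≗D′
  Θ-cong (e ∷ E) D≗D′ = +-cong (Θ-cong E D≗D′) (Θ-cong E (λ i → cong (_+ inc i e) (D≗D′ i)))

  Θ-swap : ∀ {n} (D : Fin n → ℕ) a b E → Θ D (a ∷ b ∷ E) ≈ Θ D (b ∷ a ∷ E)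
  Θ-swap D a b E = begin
    (Θ D E ⊕ Θ (addEdge D b) E) ⊕ (Θ (addEdge D a) E ⊕ Θ (addEdge (addEdge D a) b) E)
      ≈⟨ solve 4 (λ p q r s → (p :+ q) :+ (r :+ s) := (p :+ r) :+ (q :+ s)) ≈-refl _ _ _ _ ⟩
    (Θ D E ⊕ Θ (addEdge D a) E) ⊕ (Θ (addEdge D b) E ⊕ Θ (addEdge (addEdge D a) b) E)
      ≈⟨ +-congˡ (+-congˡ (Θ-cong E (addEdge-comm D a b))) ⟩
    (Θ D E ⊕ Θ (addEdge D a) E) ⊕ (Θ (addEdge D b) E ⊕ Θ (addEdge (addEdge D b) a) E) ∎

  Θ-↭ : ∀ {n} {E E′ : List (Fin n × Fin n)} → E ↭ E′ → ∀ D → Θ D E ≈ Θ D E′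
  Θ-↭ ↭.refl D = ≈-refl
  Θ-↭ (prep e E↭E′) D = +-cong (Θ-↭ E↭E′ D) (Θ-↭ E↭E′ (addEdge D e))
  Θ-↭ (swap {xs = E} a b E↭E′) D = ≈-trans (Θ-swap D a b E)
    (+-cong (+-cong (Θ-↭ E↭E′ D) (Θ-↭ E↭E′ _)) (+-cong (Θ-↭ E↭E′ _) (Θ-↭ E↭E′ _)))
  Θ-↭ (↭.trans E↭E′ E′↭E″) D = ≈-trans (Θ-↭ E↭E′ D) (Θ-↭ E′↭E″ D)

  module _ {n} (u v : Fin (suc (suc n))) (u≢v : u ≢ v) where
    open Contraction u v u≢v

    weight-split : ∀ D → weight D ≈ F (D v) ⊗ (F (D (punchIn v ū)) ⊗ weight (λ j → D (others j)))
    weight-split D = ≈-trans (prodFin-punchIn (suc n) v (λ i → F (D i)))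
                             (*-congˡ (prodFin-punchIn n ū (λ k → F (D (punchIn v k)))))

    weight-contract : ∀ D → weight D ⊕ weight (addEdge D (u , v)) ≈ weight (push D)
    weight-contract D = begin
      weight D ⊕ weight D⁺
        ≈⟨ +-cong (weight-split D) (weight-split D⁺) ⟩
      F (D v) ⊗ (F (D u′) ⊗ weight (λ j → D (others j))) ⊕ F (D⁺ v) ⊗ (F (D⁺ u′) ⊗ weight (λ j → D⁺ (others j)))
        ≈⟨ +-congˡ (*-cong (F-cong (addEdge-v D)) (*-cong (F-cong (addEdge-u D)) (weight-cong (addEdge-others D)))) ⟩
      F (D v) ⊗ (F (D u′) ⊗ rest) ⊕ F (suc (D v)) ⊗ (F (suc (D u′)) ⊗ rest)
        ≈⟨ solve 5 (λ a b c d r → a :* (b :* r) :+ c :* (d :* r) := (b :* a :+ d :* c) :* r) ≈-refl _ _ _ _ _ ⟩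
      (F (D u′) ⊗ F (D v) ⊕ F (suc (D u′)) ⊗ F (suc (D v))) ⊗ rest
        ≈⟨ *-congʳ (≈-sym (f-+ (D u′) (D v))) ⟩
      F (D u′ + D v) ⊗ rest
        ≈⟨ ≈-sym (*-cong (F-cong (push-ū D)) (weight-cong (push-others D))) ⟩
      F (push D ū) ⊗ weight (λ j → push D (punchIn ū j))
        ≈⟨ ≈-sym (prodFin-punchIn n ū (λ k → F (push D k))) ⟩
      weight (push D) ∎
      where
      D⁺ = addEdge D (u , v)
      u′ = punchIn v ū
      rest = weight (λ j → D (others j))

    Θ-contract : ∀ E D → Θ D ((u , v) ∷ E) ≈ Θ (push D) (map mergeEdge E)
    Θ-contract [] D = weight-contract D
    Θ-contract (e ∷ E) D = begin
      Θ D ((u , v) ∷ e ∷ E)                                 ≈⟨ Θ-swap D (u , v) e E ⟩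
      Θ D ((u , v) ∷ E) ⊕ Θ (addEdge D e) ((u , v) ∷ E)     ≈⟨ +-cong (Θ-contract E D) (Θ-contract E (addEdge D e)) ⟩
      Θ (push D) (map mergeEdge E) ⊕ Θ (push (addEdge D e)) (map mergeEdge E)
        ≈⟨ +-congˡ (Θ-cong (map mergeEdge E) (push-addEdge D e)) ⟩
      Θ (push D) (map mergeEdge (e ∷ E)) ∎

  sumUpTo : (ℕ → Carrier) → ℕ → Carrier
  sumUpTo g n = sumL (applyUpTo g n)

  sumUpTo-cong : ∀ n {g h : ℕ → Carrier} → (∀ k → g k ≈ h k) → sumUpTo g n ≈ sumUpTo h n
  sumUpTo-cong zero g≈h = ≈-refl
  sumUpTo-cong (suc n) g≈h = +-cong (g≈h 0) (sumUpTo-cong n (λ k → g≈h (suc k)))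

  sumUpTo-+ : ∀ n (g h : ℕ → Carrier) → sumUpTo (λ k → g k ⊕ h k) n ≈ sumUpTo g n ⊕ sumUpTo h n
  sumUpTo-+ zero g h = ≈-sym (+-identityʳ 0#)
  sumUpTo-+ (suc n) g h = ≈-trans (+-congˡ (sumUpTo-+ n (λ k → g (suc k)) (λ k → h (suc k))))
    (solve 4 (λ a b c d → (a :+ b) :+ (c :+ d) := (a :+ c) :+ (b :+ d)) ≈-refl _ _ _ _)

  sumUpTo-suc : ∀ n (g : ℕ → Carrier) → sumUpTo g (suc n) ≈ sumUpTo g n ⊕ g n
  sumUpTo-suc zero g = +-comm _ _
  sumUpTo-suc (suc n) g = ≈-trans (+-congˡ (sumUpTo-suc n (λ k → g (suc k)))) (≈-sym (+-assoc _ _ _))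

  ·-+ : ∀ a b y → (a + b) · y ≈ a · y ⊕ b · y
  ·-+ zero b y = ≈-sym (+-identityˡ _)
  ·-+ (suc a) b y = ≈-trans (+-congˡ (·-+ a b y)) (≈-sym (+-assoc _ _ _))

  binomSum : ℕ → ℕ → Carrier
  binomSum N d = sumUpTo (λ k → (N C k) · F (d + 2 * k)) (suc N)

  binomSum-suc : ∀ N d → binomSum (suc N) d ≈ binomSum N d ⊕ binomSum N (d + 2)
  binomSum-suc N d = begin
    c₀ ⊕ sumUpTo (λ k → (suc N C suc k) · F (d + 2 * suc k)) (suc N)
      ≈⟨ +-congˡ (sumUpTo-cong (suc N) pascal) ⟩
    c₀ ⊕ sumUpTo (λ k → g k ⊕ h k) (suc N)
      ≈⟨ +-congˡ (sumUpTo-+ (suc N) g h) ⟩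
    c₀ ⊕ (sumUpTo g (suc N) ⊕ sumUpTo h (suc N))
      ≈⟨ +-congˡ (+-cong (sumUpTo-cong (suc N) (λ k → ≈-reflexive (cong (λ l → (N C k) · F l) (shift-two k)))) (sumUpTo-suc N h)) ⟩
    c₀ ⊕ (binomSum N (d + 2) ⊕ (sumUpTo h N ⊕ (N C suc N) · F (d + 2 * suc N)))
      ≈⟨ +-congˡ (+-congˡ (+-congˡ (≈-reflexive (cong (_· F (d + 2 * suc N)) (k>n⇒nCk≡0 (ℕ.n<1+n N)))))) ⟩
    c₀ ⊕ (binomSum N (d + 2) ⊕ (sumUpTo h N ⊕ 0#))
      ≈⟨ solve 3 (λ a b c → a :+ (b :+ (c :+ con 0)) := (a :+ c) :+ b) ≈-refl _ _ _ ⟩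
    binomSum N d ⊕ binomSum N (d + 2) ∎
    where
    c₀ = (suc N C 0) · F (d + 2 * 0)
    g h : ℕ → Carrier
    g k = (N C k) · F (d + 2 * suc k)
    h k = (N C suc k) · F (d + 2 * suc k)
    pascal : ∀ k → (suc N C suc k) · F (d + 2 * suc k) ≈ g k ⊕ h k
    pascal k = ≈-trans (≈-reflexive (cong (_· F (d + 2 * suc k)) (sym (nCk+nC[k+1]≡[n+1]C[k+1] N k))))
                       (·-+ (N C k) (N C suc k) (F (d + 2 * suc k)))
    shift-two : ∀ k → d + 2 * suc k ≡ (d + 2) + 2 * k
    shift-two k = trans (cong (d +_) (ℕ.*-suc 2 k)) (sym (ℕ.+-assoc d 2 (2 * k)))

  Θ-singleVertex : ∀ (E : List (Fin 1 × Fin 1)) D → Θ D E ≈ binomSum (length E) (D fzero)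
  Θ-singleVertex [] D = begin
    F (D fzero) ⊗ 1#                   ≈⟨ *-identityʳ _ ⟩
    F (D fzero)                        ≈⟨ F-cong (sym (ℕ.+-identityʳ (D fzero))) ⟩
    F (D fzero + 0)                    ≈⟨ solve 1 (λ y → y := (y :+ con 0) :+ con 0) ≈-refl _ ⟩
    (F (D fzero + 0) ⊕ 0#) ⊕ 0#        ∎
  Θ-singleVertex ((fzero , fzero) ∷ E) D =
    ≈-trans (+-cong (Θ-singleVertex E D) (Θ-singleVertex E _)) (≈-sym (binomSum-suc (length E) (D fzero)))

  Θ-connected : ∀ n (E : List (Fin (suc n) × Fin (suc n))) → Connectedˡ E →
                Θ (λ _ → 0) E ≈ binomSum (length E ∸ n) 0
  Θ-connected zero E _ = Θ-singleVertex E (λ _ → 0)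
  Θ-connected (suc n) E connected
    with u , v , u≢v , uv∈E ← nonLoopEdge (connected fzero (fsuc fzero)) (λ ())
    with E′ , E↭uvE′ ← ∈⇒↭∷ uv∈E = begin
      Θ (λ _ → 0) E                             ≈⟨ Θ-↭ E↭uvE′ _ ⟩
      Θ (λ _ → 0) ((u , v) ∷ E′)                ≈⟨ Θ-contract u v u≢v E′ _ ⟩
      Θ (push (λ _ → 0)) (map mergeEdge E′)     ≈⟨ Θ-cong (map mergeEdge E′) push-zero ⟩
      Θ (λ _ → 0) (map mergeEdge E′)
        ≈⟨ Θ-connected n (map mergeEdge E′) (Connectedˡ-merge (Connectedˡ-resp-↭ E↭uvE′ connected)) ⟩
      binomSum (length (map mergeEdge E′) ∸ n) 0
        ≡⟨ cong (λ L → binomSum (L ∸ suc n) 0) (trans (cong suc (List.length-map mergeEdge E′)) (sym (↭-length E↭uvE′))) ⟩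
      binomSum (length E ∸ suc n) 0 ∎
    where open Contraction u v u≢v

  sumL-++ : ∀ xs ys → sumL (xs ++ ys) ≈ sumL xs ⊕ sumL ys
  sumL-++ [] ys = ≈-sym (+-identityˡ _)
  sumL-++ (a ∷ xs) ys = ≈-trans (+-congˡ (sumL-++ xs ys)) (≈-sym (+-assoc _ _ _))

  sumL-map-cong : ∀ {A : Set} {g h : A → Carrier} xs → (∀ a → g a ≈ h a) → sumL (map g xs) ≈ sumL (map h xs)
  sumL-map-cong [] g≈h = ≈-refl
  sumL-map-cong (a ∷ xs) g≈h = +-cong (g≈h a) (sumL-map-cong xs g≈h)

  θ⁺ : ∀ {n m} → Vec (Fin n × Fin n) m → (Fin n → ℕ) → Carrier
  θ⁺ {m = m} E D = sumL (map (λ s → (1# ^ size s) ⊗ weight (λ i → D i + degree E s i)) (allSubsets m))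

  θ⁺≈Θ : ∀ {n m} (E : Vec (Fin n × Fin n) m) → (∀ k → proj₁ (lookup E k) ≢ proj₂ (lookup E k)) →
         ∀ D → θ⁺ E D ≈ Θ D (toList E)
  θ⁺≈Θ [] _ D = begin
    1# ⊗ weight (λ i → D i + 0) ⊕ 0#    ≈⟨ solve 1 (λ a → con 1 :* a :+ con 0 := a) ≈-refl _ ⟩
    weight (λ i → D i + 0)              ≈⟨ weight-cong (λ i → ℕ.+-identityʳ (D i)) ⟩
    weight D                            ∎
  θ⁺≈Θ {n} {suc m} ((a , b) ∷ E) loopless D = begin
    sumL (map G (map (true ∷_) S ++ map (false ∷_) S))
      ≡⟨ cong sumL (trans (List.map-++ G (map (true ∷_) S) (map (false ∷_) S))
                          (sym (cong₂ _++_ (List.map-∘ {g = G} {f = true ∷_} S) (List.map-∘ {g = G} {f = false ∷_} S)))) ⟩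
    sumL (map G₁ S ++ map G₀ S)
      ≈⟨ ≈-trans (sumL-++ (map G₁ S) (map G₀ S)) (+-comm _ _) ⟩
    θ⁺ E D ⊕ sumL (map G₁ S)
      ≈⟨ +-cong (θ⁺≈Θ E (λ k → loopless (fsuc k)) D)
                (≈-trans (sumL-map-cong S included) (θ⁺≈Θ E (λ k → loopless (fsuc k)) (addEdge D (a , b)))) ⟩
    Θ D (toList E) ⊕ Θ (addEdge D (a , b)) (toList E) ∎
    where
    S = allSubsets m
    G : Vec Bool (suc m) → Carrier
    G s = (1# ^ size s) ⊗ weight (λ i → D i + degree ((a , b) ∷ E) s i)
    G₀ G₁ : Vec Bool m → Carrier
    G₀ s = G (false ∷ s)
    G₁ s = G (true ∷ s)
    included : ∀ s → G₁ s ≈ (1# ^ size s) ⊗ weight (λ i → addEdge D (a , b) i + degree E s i)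
    included s = *-cong (*-identityˡ _) (weight-cong (λ i →
      trans (cong (λ t → D i + (t + degree E s i)) (incident≡inc i a b (loopless fzero)))
            (sym (ℕ.+-assoc (D i) (inc i (a , b)) (degree E s i)))))

lemma3 : ∀ {c ℓ} (R : CommutativeRing c ℓ) (n m : ℕ) (E : Vec (Fin n × Fin n) m) →
           0 < n → SimpleEdges E → Connected E →
           (ξ ξinv : CommutativeRing.Carrier R) →
           CommutativeRing._≈_ R (CommutativeRing._*_ R ξ ξinv) (CommutativeRing.1# R) →
           CommutativeRing._≈_ R
             (RingDefs.θ R E (CommutativeRing.1# R) ξ ξinv)
             (RingDefs.rhs R ((m + 1) ∸ n) (CommutativeRing._-_ R ξ ξinv))
lemma3 R (suc n) m E _ (increasing , _) connected ξ ξinv _ = begin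
  θ⁺ E (λ _ → 0)                         ≈⟨ θ⁺≈Θ E (λ k eq → ℕ.<-irrefl (cong toℕ eq) (increasing k)) _ ⟩
  Θ (λ _ → 0) (toList E)                 ≈⟨ Θ-connected n (toList E) (Connected⇒Connectedˡ connected) ⟩
  binomSum (length (toList E) ∸ n) 0     ≡⟨ cong (λ L → binomSum (L ∸ n) 0) (Vec.length-toList E) ⟩
  binomSum (m ∸ n) 0                     ≡⟨ cong (λ L → binomSum (L ∸ suc n) 0) (ℕ.+-comm 1 m) ⟩
  binomSum ((m + 1) ∸ suc n) 0           ≡⟨ cong sumL (sym (List.map-upTo _ (suc ((m + 1) ∸ suc n)))) ⟩
  rhs ((m + 1) ∸ suc n) (ξ - ξinv)       ∎
  where
  open CommutativeRing R using (_-_; setoid)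
  open RingDefs R using (rhs; sumL)
  open Expansion R (ξ - ξinv)
  open import Relation.Binary.Reasoning.Setoid setoid
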